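{- Let $\mu$ be a partition and write the Hall-Littlewood function as $H_\mu[X;t]=\sum_\lambda d_{\mu\lambda}(t)\,g_\lambda$ with $d_{\mu\lambda}(t)\in\mathbb{Z}[t]$. Then $\sum_\lambda d_{\mu\lambda}(t)=t^{n(\mu)}$, where $n(\mu)=\sum_{i\ge1}(i-1)\mu_i$.
   Context: Ferrers diagrams in French convention (row 1 at the bottom). Semistandard tableau: positive integers weakly increasing in rows, strictly increasing up columns; evaluation counts entries equal to each $i$; reading word: rows top to bottom, each left to right; $SST(\lambda,\mu)$ = semistandard tableaux of shape $\lambda$ and evaluation $\mu$; $s_\lambda=\sum_T x^{ev(T)}$ over semistandard $T$ of shape $\lambda$. Charge: for a permutation word $w$ of $\{1,\dots,m\}$, $c_1=0$ and $c_i=c_{i-1}+1$ if $i$ appears to the right of $i-1$ in $w$, else $c_i=c_{i-1}$; $ch(w)=\sum_i c_i$. For a word whose evaluation is a partition, the first charge subword is obtained by scanning from the right end leftward, marking the first $1$, then continuing leftward (cycling from the beginning back to the end if needed) marking the first $2$, etc., until the largest letter is marked; remove the marked letters and repeat to get further charge subwords; $ch(w)$ is the sum of the charges of the charge subwords. $H_\mu[X;t]=\sum_\lambda\sum_{T\in SST(\lambda,\mu)}t^{ch(w(T))}s_\lambda$. A reverse plane partition is a filling with positive integers weakly increasing along rows and up columns; its evaluation $(\alpha_i)$ has $\alpha_i$ = number of columns containing $i$; $g_\lambda=\sum_R x^{ev(R)}$ over reverse plane partitions of shape $\lambda$ (the $g_\lambda$ form a basis of the ring of symmetric functions). -}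

module Defs where

open import Data.Nat using (ℕ; zero; suc; _+_; _*_; _∸_; _⊔_; _⊓_; _≤ᵇ_; _<ᵇ_; _≡ᵇ_)
open import Data.Bool using (Bool; true; false; _∧_; _∨_; not; if_then_else_; T)
open import Data.List using (List; []; _∷_; length; map; concat; concatMap; reverse; zip; upTo; applyUpTo)
open import Data.List.Relation.Unary.All using (All)
open import Data.Product using (_×_; _,_; proj₁; proj₂)
open import Data.Maybe using (Maybe; just; nothing)
open import Data.Integer as ℤ using (ℤ; +_)
open import Relation.Binary.PropositionalEquality using (_≡_)

keep : {A : Set} → (A → Bool) → List A → List A
keep p [] = []
keep p (x ∷ xs) = if p x then x ∷ keep p xs else keep p xs

allᵇ : {A : Set} → (A → Bool) → List A → Bool
allᵇ p [] = true
allᵇ p (x ∷ xs) = p x ∧ allᵇ p xs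

anyᵇ : {A : Set} → (A → Bool) → List A → Bool
anyᵇ p [] = false
anyᵇ p (x ∷ xs) = p x ∨ anyᵇ p xs

sumℕ : List ℕ → ℕ
sumℕ [] = 0
sumℕ (x ∷ xs) = x + sumℕ xs

sumℤ : List ℤ → ℤ
sumℤ [] = + 0
sumℤ (x ∷ xs) = x ℤ.+ sumℤ xs

maxℕ : List ℕ → ℕ
maxℕ [] = 0
maxℕ (x ∷ xs) = x ⊔ maxℕ xs

range1 : ℕ → List ℕ
range1 m = applyUpTo suc m

-- 1-based indexing of a list of naturals, 0 outside the list
-- (so a composition alpha is the exponent vector alpha_1, alpha_2, ...)
at : List ℕ → ℕ → ℕ
at [] _ = 0
at (x ∷ xs) zero = 0
at (x ∷ xs) (suc zero) = x
at (x ∷ xs) (suc (suc i)) = at xs (suc i)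

countEq : ℕ → List ℕ → ℕ
countEq i w = length (keep (λ x → x ≡ᵇ i) w)

weaklyDecr : List ℕ → Bool
weaklyDecr [] = true
weaklyDecr (x ∷ []) = true
weaklyDecr (x ∷ y ∷ r) = (y ≤ᵇ x) ∧ weaklyDecr (y ∷ r)

weaklyIncr : List ℕ → Bool
weaklyIncr [] = true
weaklyIncr (x ∷ []) = true
weaklyIncr (x ∷ y ∷ r) = (x ≤ᵇ y) ∧ weaklyIncr (y ∷ r)

positive : ℕ → Bool
positive n = 1 ≤ᵇ n

isPartitionᵇ : List ℕ → Bool
isPartitionᵇ l = weaklyDecr l ∧ allᵇ positive l

IsPartition : List ℕ → Set
IsPartition l = T (isPartitionᵇ l)

size : List ℕ → ℕ
size = sumℕ

nAux : ℕ → List ℕ → ℕ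
nAux i [] = 0
nAux i (x ∷ xs) = i * x + nAux (suc i) xs

nOf : List ℕ → ℕ
nOf = nAux 0

-- all partitions of n with parts <= k (fuel bounds the recursion depth)
partsAux : ℕ → ℕ → ℕ → List (List ℕ)
partsAux _ zero k = [] ∷ []
partsAux zero (suc n) k = []
partsAux (suc f) (suc n) k =
  concatMap (λ p → map (p ∷_) (partsAux f (suc n ∸ p) p)) (range1 (k ⊓ suc n))

partitionsOf : ℕ → List (List ℕ)
partitionsOf n = partsAux n n n

-- Fillings of a Ferrers diagram (French convention).
-- A filling is the list of its rows, row 1 (the bottom, longest row) first;
-- rows are left-justified, so cell j of row i+1 sits on top of cell j of row i.

Filling : Set
Filling = List (List ℕ)

words : ℕ → ℕ → List (List ℕ)
words zero m = [] ∷ []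
words (suc k) m = concatMap (λ a → map (a ∷_) (words k m)) (range1 m)

fillings : List ℕ → ℕ → List Filling
fillings [] m = [] ∷ []
fillings (r ∷ lam) m = concatMap (λ w → map (w ∷_) (fillings lam m)) (words r m)

-- compare vertically adjacent cells: f (lower) (upper)
pairsᵇ : (ℕ → ℕ → Bool) → List ℕ → List ℕ → Bool
pairsᵇ f (l ∷ ls) (u ∷ us) = f l u ∧ pairsᵇ f ls us
pairsᵇ f _ _ = true

columnsᵇ : (ℕ → ℕ → Bool) → Filling → Bool
columnsᵇ f (L ∷ U ∷ rs) = pairsᵇ f L U ∧ columnsᵇ f (U ∷ rs)
columnsᵇ f _ = true

entries : Filling → List ℕ
entries = concat

isSST : Filling → Bool
isSST F = allᵇ positive (entries F) ∧ allᵇ weaklyIncr F ∧ columnsᵇ _<ᵇ_ F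

isRPP : Filling → Bool
isRPP F = allᵇ positive (entries F) ∧ allᵇ weaklyIncr F ∧ columnsᵇ _≤ᵇ_ F

-- evaluation of a tableau: number of entries equal to i is alpha_i, for all i >= 1
-- (checked up to a bound beyond which both sides vanish)
hasEvSST : List ℕ → Filling → Bool
hasEvSST α F = allᵇ (λ i → countEq i (entries F) ≡ᵇ at α i)
                    (range1 (length α + maxℕ (entries F)))

-- j-th column (0-based) of a filling
nth0 : List ℕ → ℕ → Maybe ℕ
nth0 [] _ = nothing
nth0 (x ∷ xs) zero = just x
nth0 (x ∷ xs) (suc j) = nth0 xs j

column : Filling → ℕ → List ℕ
column [] j = []
column (r ∷ rs) j with nth0 r j
... | just x = x ∷ column rs j
... | nothing = column rs j

numCols : Filling → ℕ
numCols F = maxℕ (map length F)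

colCount : Filling → ℕ → ℕ
colCount F i = length (keep (λ j → anyᵇ (λ x → x ≡ᵇ i) (column F j)) (upTo (numCols F)))

hasEvRPP : List ℕ → Filling → Bool
hasEvRPP α F = allᵇ (λ i → colCount F i ≡ᵇ at α i)
                    (range1 (length α + maxℕ (entries F)))

-- SST(lam, alpha).  Any filling with evaluation alpha only uses entries
-- i with alpha_i > 0, hence entries <= length alpha, so this is all of them.
SST : List ℕ → List ℕ → List Filling
SST lam α = keep (λ F → isSST F ∧ hasEvSST α F) (fillings lam (length α))

RPP : List ℕ → List ℕ → List Filling
RPP lam α = keep (λ F → isRPP F ∧ hasEvRPP α F) (fillings lam (length α))

schurCoeff : List ℕ → List ℕ → ℕ
schurCoeff lam α = length (SST lam α)

gCoeff : List ℕ → List ℕ → ℕ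
gCoeff lam α = length (RPP lam α)

readingWord : Filling → List ℕ
readingWord F = concat (reverse F)

posOf : ℕ → List ℕ → ℕ
posOf i [] = 0
posOf i (x ∷ xs) = if x ≡ᵇ i then 0 else suc (posOf i xs)

-- c_i = c_{i-1} + 1 if i is to the right of i-1, else c_{i-1}; returns sum_{j >= i} c_j
permChargeAux : List ℕ → ℕ → ℕ → ℕ → ℕ
permChargeAux v zero i c = 0
permChargeAux v (suc k) i c =
  let c′ = if posOf (i ∸ 1) v <ᵇ posOf i v then suc c else c
  in c′ + permChargeAux v k (suc i) c′

-- charge of a permutation word of {1..m}  (c_1 = 0)
permCharge : List ℕ → ℕ
permCharge v = permChargeAux v (length v ∸ 1) 2 0

Tagged : Set
Tagged = List (ℕ × ℕ)   -- (position, letter)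

tag : List ℕ → Tagged
tag w = zip (upTo (length w)) w

rightmostBefore : ℕ → ℕ → Tagged → Maybe ℕ
rightmostBefore i p [] = nothing
rightmostBefore i p ((q , x) ∷ ws) with rightmostBefore i p ws
... | just r = just r
... | nothing = if (x ≡ᵇ i) ∧ (q <ᵇ p) then just q else nothing

-- continue leftward from position p looking for letter i, cycling to the
-- right end if necessary
pick : ℕ → ℕ → Tagged → Maybe ℕ
pick i p ws with rightmostBefore i p ws
... | just q = just q
... | nothing = rightmostBefore i (suc (maxℕ (map proj₁ ws))) ws

marks : ℕ → ℕ → ℕ → Tagged → List ℕ
marks zero i p ws = []
marks (suc k) i p ws with pick i p ws
... | just q = q ∷ marks k (suc i) q ws
... | nothing = []

memℕ : ℕ → List ℕ → Bool
memℕ x ys = anyᵇ (λ y → y ≡ᵇ x) ys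

-- sum of the charges of the successive charge subwords
chargeTagged : ℕ → Tagged → ℕ
chargeTagged zero ws = 0
chargeTagged (suc f) [] = 0
chargeTagged (suc f) (w ∷ ws) =
  let P   = marks (maxℕ (map proj₂ (w ∷ ws))) 1 (suc (maxℕ (map proj₁ (w ∷ ws)))) (w ∷ ws)
      sub = map proj₂ (keep (λ e → memℕ (proj₁ e) P) (w ∷ ws))
      rst = keep (λ e → not (memℕ (proj₁ e) P)) (w ∷ ws)
  in permCharge sub + chargeTagged f rst

charge : List ℕ → ℕ
charge w = chargeTagged (length w) (tag w)

-- Polynomials in t with integer coefficients, as coefficient lists
-- (entry k = coefficient of t^k)

Poly : Set
Poly = List ℤ

coeff : Poly → ℕ → ℤ
coeff [] k = + 0
coeff (a ∷ p) zero = a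
coeff (a ∷ p) (suc k) = coeff p k

tPowCoeff : ℕ → ℕ → ℤ
tPowCoeff n k = if n ≡ᵇ k then + 1 else + 0

-- Hall-Littlewood H_mu[X;t] = sum_lam sum_{T in SST(lam,mu)} t^{ch(w(T))} s_lam.
-- Coefficient of x^alpha t^k.  (SST(lam,mu) is empty unless |lam| = |mu|.)

HCoeff : List ℕ → List ℕ → ℕ → ℕ
HCoeff μ α k =
  sumℕ (map (λ lam → length (keep (λ F → charge (readingWord F) ≡ᵇ k) (SST lam μ))
                     * schurCoeff lam α)
            (partitionsOf (size μ)))

GExpansion : List ℕ → List (List ℕ × Poly) → Set
GExpansion μ d =
  All (λ e → IsPartition (proj₁ e)) d ×
  (∀ (α : List ℕ) (k : ℕ) →
     + HCoeff μ α k ≡ sumℤ (map (λ e → coeff (proj₂ e) k ℤ.* + gCoeff (proj₁ e) α) d))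

sumCoeffs : List (List ℕ × Poly) → ℕ → ℤ
sumCoeffs d k = sumℤ (map (λ e → coeff (proj₂ e) k) d)

module Submission where

-- Specialise to a single variable x, i.e. take α = (m).  Then g_λ(x) = x^{λ₁}
-- (the only reverse plane partition has all entries 1, one per column), while
-- s_λ(x) vanishes unless λ is a single row, and SST((n), μ) consists of the
-- single row word 1^{μ₁} 2^{μ₂} ⋯, whose charge is n(μ): each charge subword
-- takes the last occurrence of every letter, so reads 1 2 ⋯ ℓ(μ) and has charge
-- 0 + 1 + ⋯ + (ℓ(μ) − 1), and removing it leaves the row word of μ with every
-- part decreased by one.  Hence H_μ(x; t) = t^{n(μ)} x^{|μ|} = Σ_λ d_{μλ}(t) x^{λ₁},
-- and summing the coefficients over all powers of x gives Σ_λ d_{μλ}(t) = t^{n(μ)}.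

open import Defs
open import Data.Bool using (Bool; true; false; _∧_; _∨_; not; if_then_else_; T)
open import Data.Bool.Properties using (∧-zeroʳ; ∧-identityʳ)
open import Data.Empty using (⊥; ⊥-elim)
open import Data.Integer as ℤ using (ℤ; +_)
import Data.Integer.Properties as ZP
open import Algebra.Properties.CommutativeSemigroup ZP.+-commutativeSemigroup using (interchange)
open import Data.List using (List; []; _∷_; length; map; concatMap; zip; upTo; applyUpTo; replicate; _++_)
open import Data.List.Properties
  using (applyUpTo-∷ʳ; ++-identityʳ; ++-assoc; length-++; length-map; length-replicate; length-upTo; map-++; map-cong)
open import Data.List.Relation.Unary.All as All using (All; []; _∷_)
open import Data.List.Relation.Unary.All.Properties
  using (++⁺; replicate⁺; map⁺; map⁻; concat⁺; applyUpTo⁺₁; applyUpTo⁺₂; applyUpTo⁻)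
open import Data.Maybe using (just; nothing)
open import Data.Nat using (ℕ; zero; suc; _+_; _*_; _∸_; _⊔_; _⊓_; _≤ᵇ_; _<ᵇ_; _≡ᵇ_; _≤_; _<_; z≤n; s≤s)
open import Data.Nat.Properties
open import Data.Nat.Solver using (module +-*-Solver)
open import Data.Product using (_×_; _,_; proj₁; proj₂)
open import Data.Sum using (_⊎_; inj₁; inj₂)
open import Data.Unit using (⊤; tt)
open import Relation.Binary using (tri<; tri≈; tri>)
open import Relation.Binary.PropositionalEquality
  using (_≡_; _≢_; refl; sym; ≢-sym; trans; cong; cong₂; subst; subst₂; module ≡-Reasoning)
open import Relation.Nullary using (yes; no)

open +-*-Solver using (solve; _:+_; _:=_)

T⇒≡true : ∀ {b} → T b → b ≡ true
T⇒≡true {true} _ = refl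

≡true⇒T : ∀ {b} → b ≡ true → T b
≡true⇒T refl = tt

true≢false : true ≢ false
true≢false ()

∧-trueˡ : ∀ a b → (a ∧ b) ≡ true → a ≡ true
∧-trueˡ true b _ = refl

∧-trueʳ : ∀ a b → (a ∧ b) ≡ true → b ≡ true
∧-trueʳ true b e = e

≡ᵇ-refl : ∀ a → (a ≡ᵇ a) ≡ true
≡ᵇ-refl zero = refl
≡ᵇ-refl (suc a) = ≡ᵇ-refl a

≢⇒≡ᵇ-false : ∀ {a b} → a ≢ b → (a ≡ᵇ b) ≡ false
≢⇒≡ᵇ-false {zero} {zero} a≢b = ⊥-elim (a≢b refl)
≢⇒≡ᵇ-false {zero} {suc b} _ = refl
≢⇒≡ᵇ-false {suc a} {zero} _ = refl
≢⇒≡ᵇ-false {suc a} {suc b} a≢b = ≢⇒≡ᵇ-false (λ e → a≢b (cong suc e))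

≡ᵇ-true⇒≡ : ∀ a b → (a ≡ᵇ b) ≡ true → a ≡ b
≡ᵇ-true⇒≡ a b e = ≡ᵇ⇒≡ a b (≡true⇒T e)

≤⇒≤ᵇ-true : ∀ {x y} → x ≤ y → (x ≤ᵇ y) ≡ true
≤⇒≤ᵇ-true x≤y = T⇒≡true (≤⇒≤ᵇ x≤y)

≤ᵇ-true⇒≤ : ∀ x y → (x ≤ᵇ y) ≡ true → x ≤ y
≤ᵇ-true⇒≤ x y e = ≤ᵇ⇒≤ x y (≡true⇒T e)

<⇒<ᵇ-true : ∀ {x y} → x < y → (x <ᵇ y) ≡ true
<⇒<ᵇ-true x<y = T⇒≡true (<⇒<ᵇ x<y)

≤⇒<ᵇ-false : ∀ {x y} → y ≤ x → (x <ᵇ y) ≡ false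
≤⇒<ᵇ-false {x} {zero} _ = refl
≤⇒<ᵇ-false {suc x} {suc y} (s≤s y≤x) = ≤⇒<ᵇ-false {x} {y} y≤x

sumℕ-++ : ∀ xs ys → sumℕ (xs ++ ys) ≡ sumℕ xs + sumℕ ys
sumℕ-++ [] ys = refl
sumℕ-++ (x ∷ xs) ys rewrite sumℕ-++ xs ys = sym (+-assoc x (sumℕ xs) (sumℕ ys))

module _ {A : Set} where

  keep-++ : ∀ (p : A → Bool) xs ys → keep p (xs ++ ys) ≡ keep p xs ++ keep p ys
  keep-++ p [] ys = refl
  keep-++ p (x ∷ xs) ys with p x
  ... | true = cong (x ∷_) (keep-++ p xs ys)
  ... | false = keep-++ p xs ys

  keep-cong : ∀ {p q : A → Bool} xs → (∀ x → p x ≡ q x) → keep p xs ≡ keep q xs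
  keep-cong [] p≗q = refl
  keep-cong {q = q} (x ∷ xs) p≗q rewrite p≗q x with q x
  ... | true = cong (x ∷_) (keep-cong xs p≗q)
  ... | false = keep-cong xs p≗q

  length-keep-none : ∀ (p : A → Bool) xs → All (λ x → p x ≡ false) xs → length (keep p xs) ≡ 0
  length-keep-none p [] [] = refl
  length-keep-none p (x ∷ xs) (px ∷ pxs) rewrite px = length-keep-none p xs pxs

  length-keep-all : ∀ (p : A → Bool) xs → All (λ x → p x ≡ true) xs → length (keep p xs) ≡ length xs
  length-keep-all p [] [] = refl
  length-keep-all p (x ∷ xs) (px ∷ pxs) rewrite px = cong suc (length-keep-all p xs pxs)

  allᵇ-++ : ∀ (p : A → Bool) xs ys → allᵇ p (xs ++ ys) ≡ allᵇ p xs ∧ allᵇ p ys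
  allᵇ-++ p [] ys = refl
  allᵇ-++ p (x ∷ xs) ys rewrite allᵇ-++ p xs ys with p x
  ... | true = refl
  ... | false = refl

  All⇒allᵇ : ∀ (p : A → Bool) {xs} → All (λ x → p x ≡ true) xs → allᵇ p xs ≡ true
  All⇒allᵇ p [] = refl
  All⇒allᵇ p (px ∷ pxs) rewrite px = All⇒allᵇ p pxs

  allᵇ⇒All : ∀ (p : A → Bool) xs → allᵇ p xs ≡ true → All (λ x → p x ≡ true) xs
  allᵇ⇒All p [] _ = []
  allᵇ⇒All p (x ∷ xs) e = ∧-trueˡ (p x) _ e ∷ allᵇ⇒All p xs (∧-trueʳ (p x) _ e)

  sumℕ-map-zero : ∀ (g : A → ℕ) {xs} → All (λ x → g x ≡ 0) xs → sumℕ (map g xs) ≡ 0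
  sumℕ-map-zero g [] = refl
  sumℕ-map-zero g (gx ∷ gxs) rewrite gx = sumℕ-map-zero g gxs

module _ {A B : Set} where

  length-keep-concatMap : ∀ (p : B → Bool) (h : A → List B) xs →
    length (keep p (concatMap h xs)) ≡ sumℕ (map (λ x → length (keep p (h x))) xs)
  length-keep-concatMap p h [] = refl
  length-keep-concatMap p h (x ∷ xs)
    rewrite keep-++ p (h x) (concatMap h xs) | length-++ (keep p (h x)) {keep p (concatMap h xs)}
          | length-keep-concatMap p h xs = refl

  length-keep-map : ∀ (p : B → Bool) (f : A → B) xs → length (keep p (map f xs)) ≡ length (keep (λ x → p (f x)) xs)
  length-keep-map p f [] = refl
  length-keep-map p f (x ∷ xs) with p (f x)
  ... | true = cong suc (length-keep-map p f xs)
  ... | false = length-keep-map p f xs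

  length-keep-keep-map : ∀ (p q : B → Bool) (f : A → B) xs →
    length (keep p (keep q (map f xs))) ≡ length (keep (λ x → q (f x) ∧ p (f x)) xs)
  length-keep-keep-map p q f [] = refl
  length-keep-keep-map p q f (x ∷ xs) with q (f x)
  ... | false = length-keep-keep-map p q f xs
  ... | true with p (f x)
  ...   | true = cong suc (length-keep-keep-map p q f xs)
  ...   | false = length-keep-keep-map p q f xs

  concatMap-singleton : ∀ (f : A → B) xs → concatMap (λ x → f x ∷ []) xs ≡ map f xs
  concatMap-singleton f [] = refl
  concatMap-singleton f (x ∷ xs) = cong (f x ∷_) (concatMap-singleton f xs)

  sumℕ-concatMap : ∀ (g : B → ℕ) (h : A → List B) xs →
    sumℕ (map g (concatMap h xs)) ≡ sumℕ (map (λ x → sumℕ (map g (h x))) xs)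
  sumℕ-concatMap g h [] = refl
  sumℕ-concatMap g h (x ∷ xs) rewrite map-++ g (h x) (concatMap h xs)
    | sumℕ-++ (map g (h x)) (map g (concatMap h xs)) | sumℕ-concatMap g h xs = refl

All-≤-maxℕ : ∀ xs → All (_≤ maxℕ xs) xs
All-≤-maxℕ [] = []
All-≤-maxℕ (x ∷ xs) = m≤m⊔n x (maxℕ xs) ∷ All.map (λ y≤ → ≤-trans y≤ (m≤n⊔m x (maxℕ xs))) (All-≤-maxℕ xs)

countEq-++ : ∀ i xs ys → countEq i (xs ++ ys) ≡ countEq i xs + countEq i ys
countEq-++ i xs ys rewrite keep-++ (λ x → x ≡ᵇ i) xs ys = length-++ (keep (λ x → x ≡ᵇ i) xs)

countEq-∷ : ∀ i a u → countEq i (a ∷ u) ≡ (if a ≡ᵇ i then suc (countEq i u) else countEq i u)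
countEq-∷ i a u with a ≡ᵇ i
... | true = refl
... | false = refl

countEq-head : ∀ a u → countEq a (a ∷ u) ≡ suc (countEq a u)
countEq-head a u rewrite ≡ᵇ-refl a = refl

countEq-none : ∀ i xs → All (_≢ i) xs → countEq i xs ≡ 0
countEq-none i xs x≢i = length-keep-none _ xs (All.map ≢⇒≡ᵇ-false x≢i)

countEq-replicate : ∀ m v → countEq v (replicate m v) ≡ m
countEq-replicate zero v = refl
countEq-replicate (suc m) v rewrite ≡ᵇ-refl v = cong suc (countEq-replicate m v)

-- Finite sums and the Kronecker delta

δ : ℕ → ℕ → ℕ
δ a b = if a ≡ᵇ b then 1 else 0

δ-refl : ∀ a → δ a a ≡ 1
δ-refl a rewrite ≡ᵇ-refl a = refl

δ-≢ : ∀ {a b} → a ≢ b → δ a b ≡ 0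
δ-≢ a≢b rewrite ≢⇒≡ᵇ-false a≢b = refl

tPowCoeff≡δ : ∀ n k → tPowCoeff n k ≡ + δ n k
tPowCoeff≡δ n k with n ≡ᵇ k
... | true = refl
... | false = refl

∑ᶻ : ℕ → (ℕ → ℤ) → ℤ
∑ᶻ zero f = + 0
∑ᶻ (suc M) f = ∑ᶻ M f ℤ.+ f M

∑ᶻ-cong : ∀ M {f g : ℕ → ℤ} → (∀ m → f m ≡ g m) → ∑ᶻ M f ≡ ∑ᶻ M g
∑ᶻ-cong zero f≗g = refl
∑ᶻ-cong (suc M) f≗g = cong₂ ℤ._+_ (∑ᶻ-cong M f≗g) (f≗g M)

∑ᶻ-zero : ∀ M → ∑ᶻ M (λ _ → + 0) ≡ + 0
∑ᶻ-zero zero = refl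
∑ᶻ-zero (suc M) rewrite ∑ᶻ-zero M = refl

∑ᶻ-+ : ∀ M (f g : ℕ → ℤ) → ∑ᶻ M (λ m → f m ℤ.+ g m) ≡ ∑ᶻ M f ℤ.+ ∑ᶻ M g
∑ᶻ-+ zero f g = refl
∑ᶻ-+ (suc M) f g rewrite ∑ᶻ-+ M f g = interchange (∑ᶻ M f) (∑ᶻ M g) (f M) (g M)

∑ᶻ-sumℤ-comm : ∀ {A : Set} M (f : A → ℕ → ℤ) xs →
  ∑ᶻ M (λ m → sumℤ (map (λ x → f x m) xs)) ≡ sumℤ (map (λ x → ∑ᶻ M (f x)) xs)
∑ᶻ-sumℤ-comm M f [] = ∑ᶻ-zero M
∑ᶻ-sumℤ-comm M f (x ∷ xs) =
  trans (∑ᶻ-+ M (f x) (λ m → sumℤ (map (λ y → f y m) xs)))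
        (cong (λ z → ∑ᶻ M (f x) ℤ.+ z) (∑ᶻ-sumℤ-comm M f xs))

∑ᶻ-δ-≥ : ∀ {a} M c → M ≤ a → ∑ᶻ M (λ m → c ℤ.* + δ a m) ≡ + 0
∑ᶻ-δ-≥ zero c _ = refl
∑ᶻ-δ-≥ (suc M) c M<a
  rewrite ∑ᶻ-δ-≥ M c (<⇒≤ M<a) | δ-≢ (λ a≡M → <-irrefl (sym a≡M) M<a) | ZP.*-zeroʳ c = refl

∑ᶻ-δ : ∀ {a} M c → a < M → ∑ᶻ M (λ m → c ℤ.* + δ a m) ≡ c
∑ᶻ-δ {a} (suc M) c a<1+M with a ≟ M
... | yes refl rewrite ∑ᶻ-δ-≥ a c ≤-refl | δ-refl a = trans (ZP.+-identityˡ (c ℤ.* + 1)) (ZP.*-identityʳ c)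
... | no a≢M rewrite ∑ᶻ-δ M c (≤∧≢⇒< (≤-pred a<1+M) a≢M) | δ-≢ a≢M | ZP.*-zeroʳ c = ZP.+-identityʳ c

-- Reverse plane partitions and Schur functions in one variable

allOnes : List ℕ → Filling
allOnes lam = map (λ r → replicate r 1) lam

words-one : ∀ r → words r 1 ≡ replicate r 1 ∷ []
words-one zero = refl
words-one (suc r) rewrite words-one r = refl

fillings-one : ∀ lam → fillings lam 1 ≡ allOnes lam ∷ []
fillings-one [] = refl
fillings-one (r ∷ lam) rewrite words-one r | fillings-one lam = refl

allOnes-positive : ∀ lam → allᵇ positive (entries (allOnes lam)) ≡ true
allOnes-positive lam =
  All⇒allᵇ positive (concat⁺ (map⁺ (All.universal (λ r → replicate⁺ r refl) lam)))

weaklyIncr-replicate : ∀ r v → weaklyIncr (replicate r v) ≡ true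
weaklyIncr-replicate zero v = refl
weaklyIncr-replicate (suc zero) v = refl
weaklyIncr-replicate (suc (suc r)) v =
  trans (cong (_∧ weaklyIncr (replicate (suc r) v)) (≤⇒≤ᵇ-true (≤-refl {v}))) (weaklyIncr-replicate (suc r) v)

allOnes-rowsIncr : ∀ lam → allᵇ weaklyIncr (allOnes lam) ≡ true
allOnes-rowsIncr lam =
  All⇒allᵇ weaklyIncr (map⁺ (All.universal (λ r → weaklyIncr-replicate r 1) lam))

pairsᵇ-≤ᵇ-replicate : ∀ a b v → pairsᵇ _≤ᵇ_ (replicate a v) (replicate b v) ≡ true
pairsᵇ-≤ᵇ-replicate zero b v = refl
pairsᵇ-≤ᵇ-replicate (suc a) zero v = refl
pairsᵇ-≤ᵇ-replicate (suc a) (suc b) v =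
  trans (cong (_∧ pairsᵇ _≤ᵇ_ (replicate a v) (replicate b v)) (≤⇒≤ᵇ-true (≤-refl {v})))
        (pairsᵇ-≤ᵇ-replicate a b v)

allOnes-columnsWeak : ∀ lam → columnsᵇ _≤ᵇ_ (allOnes lam) ≡ true
allOnes-columnsWeak [] = refl
allOnes-columnsWeak (a ∷ []) = refl
allOnes-columnsWeak (a ∷ b ∷ lam) =
  trans (cong (_∧ columnsᵇ _≤ᵇ_ (allOnes (b ∷ lam))) (pairsᵇ-≤ᵇ-replicate a b 1)) (allOnes-columnsWeak (b ∷ lam))

allOnes-isRPP : ∀ lam → isRPP (allOnes lam) ≡ true
allOnes-isRPP lam rewrite allOnes-positive lam | allOnes-rowsIncr lam | allOnes-columnsWeak lam = refl

nth0-replicate : ∀ r v j → nth0 (replicate r v) j ≡ (if j <ᵇ r then just v else nothing)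
nth0-replicate zero v j = refl
nth0-replicate (suc r) v zero = refl
nth0-replicate (suc r) v (suc j) = nth0-replicate r v j

column-∷-replicate : ∀ r F j → column (replicate r 1 ∷ F) j ≡ (if j <ᵇ r then 1 ∷ column F j else column F j)
column-∷-replicate r F j rewrite nth0-replicate r 1 j with j <ᵇ r
... | true = refl
... | false = refl

<⊔-≤⇒< : ∀ {j r M} → j < r ⊔ M → r ≤ j → j < M
<⊔-≤⇒< {j} {r} {M} j<r⊔M r≤j with M ≤? j
... | yes M≤j = ⊥-elim (<-irrefl refl (<-≤-trans j<r⊔M (⊔-lub r≤j M≤j)))
... | no M≰j = ≰⇒> M≰j

column-allOnes-has-1 : ∀ lam j → j < maxℕ lam → anyᵇ (λ x → x ≡ᵇ 1) (column (allOnes lam) j) ≡ true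
column-allOnes-has-1 (r ∷ lam) j j<max rewrite column-∷-replicate r (allOnes lam) j with j <? r
... | yes j<r rewrite <⇒<ᵇ-true j<r = refl
... | no j≮r rewrite ≤⇒<ᵇ-false (≮⇒≥ j≮r) = column-allOnes-has-1 lam j (<⊔-≤⇒< j<max (≮⇒≥ j≮r))

column-allOnes-lacks-2+ : ∀ lam j i → anyᵇ (λ x → x ≡ᵇ suc (suc i)) (column (allOnes lam) j) ≡ false
column-allOnes-lacks-2+ [] j i = refl
column-allOnes-lacks-2+ (r ∷ lam) j i rewrite column-∷-replicate r (allOnes lam) j with j <ᵇ r
... | true = column-allOnes-lacks-2+ lam j i
... | false = column-allOnes-lacks-2+ lam j i

numCols-allOnes : ∀ lam → numCols (allOnes lam) ≡ maxℕ lam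
numCols-allOnes [] = refl
numCols-allOnes (r ∷ lam) = cong₂ _⊔_ (length-replicate r) (numCols-allOnes lam)

colCount-allOnes-1 : ∀ lam → colCount (allOnes lam) 1 ≡ maxℕ lam
colCount-allOnes-1 lam rewrite numCols-allOnes lam =
  trans (length-keep-all _ (upTo (maxℕ lam)) (applyUpTo⁺₁ _ _ (column-allOnes-has-1 lam _)))
        (length-upTo (maxℕ lam))

colCount-allOnes-2+ : ∀ lam i → colCount (allOnes lam) (suc (suc i)) ≡ 0
colCount-allOnes-2+ lam i =
  length-keep-none _ (upTo (numCols (allOnes lam))) (All.universal (λ j → column-allOnes-lacks-2+ lam j i) _)

allᵇ-range1-tail : ∀ (p : ℕ → Bool) N → (∀ i → p (suc (suc i)) ≡ true) → allᵇ p (range1 (suc N)) ≡ p 1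
allᵇ-range1-tail p N p2+ rewrite All⇒allᵇ p (applyUpTo⁺₂ (λ i → suc (suc i)) N p2+) = ∧-identityʳ (p 1)

hasEvRPP-allOnes : ∀ lam m → hasEvRPP (m ∷ []) (allOnes lam) ≡ (maxℕ lam ≡ᵇ m)
hasEvRPP-allOnes lam m =
  trans (allᵇ-range1-tail (λ i → colCount (allOnes lam) i ≡ᵇ at (m ∷ []) i) (maxℕ (entries (allOnes lam)))
                          (λ i → cong (_≡ᵇ 0) (colCount-allOnes-2+ lam i)))
        (cong (_≡ᵇ m) (colCount-allOnes-1 lam))

gCoeff-oneVariable : ∀ lam m → gCoeff lam (m ∷ []) ≡ δ (maxℕ lam) m
gCoeff-oneVariable lam m rewrite fillings-one lam | allOnes-isRPP lam | hasEvRPP-allOnes lam m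
  with maxℕ lam ≡ᵇ m
... | true = refl
... | false = refl

schurCoeff-oneVariable-twoRows : ∀ a b lam m → schurCoeff (suc a ∷ suc b ∷ lam) (m ∷ []) ≡ 0
schurCoeff-oneVariable-twoRows a b lam m
  rewrite fillings-one (suc a ∷ suc b ∷ lam) | allOnes-positive (suc a ∷ suc b ∷ lam)
        | allOnes-rowsIncr (suc a ∷ suc b ∷ lam) = refl

schurCoeff-oneVariable-oneRow : ∀ n m → schurCoeff (n ∷ []) (m ∷ []) ≡ δ n m
schurCoeff-oneVariable-oneRow n m
  rewrite fillings-one (n ∷ []) | allOnes-positive (n ∷ []) | allOnes-rowsIncr (n ∷ [])
        | ++-identityʳ (replicate n 1)
        | allᵇ-range1-tail (λ i → countEq i (replicate n 1) ≡ᵇ at (m ∷ []) i) (maxℕ (replicate n 1))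
            (λ i → cong (_≡ᵇ 0) (countEq-none _ (replicate n 1) (replicate⁺ n (λ ()))))
        | countEq-replicate n 1
  with n ≡ᵇ m
... | true = refl
... | false = refl

sumℕ-map-range1-suc : ∀ (F : ℕ → ℕ) m → sumℕ (map F (range1 (suc m))) ≡ sumℕ (map F (range1 m)) + F (suc m)
sumℕ-map-range1-suc F m = begin
  sumℕ (map F (range1 (suc m)))                     ≡⟨ cong (λ ps → sumℕ (map F ps)) (sym (applyUpTo-∷ʳ suc m)) ⟩
  sumℕ (map F (range1 m ++ suc m ∷ []))             ≡⟨ cong sumℕ (map-++ F (range1 m) (suc m ∷ [])) ⟩
  sumℕ (map F (range1 m) ++ F (suc m) ∷ [])         ≡⟨ sumℕ-++ (map F (range1 m)) (F (suc m) ∷ []) ⟩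
  sumℕ (map F (range1 m)) + (F (suc m) + 0)         ≡⟨ cong (λ z → sumℕ (map F (range1 m)) + z) (+-identityʳ (F (suc m))) ⟩
  sumℕ (map F (range1 m)) + F (suc m)               ∎
  where open ≡-Reasoning

StartsPositive : List ℕ → Set
StartsPositive (suc _ ∷ _) = ⊤
StartsPositive _ = ⊥

partsAux-startsPositive : ∀ f x k → All StartsPositive (partsAux f (suc x) k)
partsAux-startsPositive zero x k = []
partsAux-startsPositive (suc f) x k =
  concat⁺ (map⁺ (applyUpTo⁺₂ suc (k ⊓ suc x) (λ _ → map⁺ (All.universal (λ _ → tt) _))))

sumℕ-partitionsOf-oneRow : ∀ n (g : List ℕ → ℕ) → (∀ a b lam → g (suc a ∷ suc b ∷ lam) ≡ 0) →
  sumℕ (map g (partitionsOf (suc n))) ≡ g (suc n ∷ [])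
sumℕ-partitionsOf-oneRow n g g-twoRows = begin
  sumℕ (map g (partitionsOf (suc n)))
    ≡⟨ sumℕ-concatMap g branch (range1 (suc n ⊓ suc n)) ⟩
  sumℕ (map branchSum (range1 (suc n ⊓ suc n)))
    ≡⟨ cong (λ N → sumℕ (map branchSum (range1 N))) (⊓-idem (suc n)) ⟩
  sumℕ (map branchSum (range1 (suc n)))
    ≡⟨ sumℕ-map-range1-suc branchSum n ⟩
  sumℕ (map branchSum (range1 n)) + branchSum (suc n)
    ≡⟨ cong (_+ branchSum (suc n)) (sumℕ-map-zero branchSum (applyUpTo⁺₁ suc n shorter-branch)) ⟩
  branchSum (suc n)
    ≡⟨ cong (λ z → sumℕ (map g (map (suc n ∷_) (partsAux n z (suc n))))) (n∸n≡0 n) ⟩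
  g (suc n ∷ []) + 0
    ≡⟨ +-identityʳ _ ⟩
  g (suc n ∷ []) ∎
  where
  open ≡-Reasoning
  branch : ℕ → List (List ℕ)
  branch p = map (p ∷_) (partsAux n (suc n ∸ p) p)
  branchSum : ℕ → ℕ
  branchSum p = sumℕ (map g (branch p))
  shorter-branch : ∀ {i} → i < n → branchSum (suc i) ≡ 0
  shorter-branch {i} i<n with n ∸ i | m>n⇒m∸n≢0 i<n
  ... | zero | n∸i≢0 = ⊥-elim (n∸i≢0 refl)
  ... | suc j | _ = sumℕ-map-zero g (map⁺ (All.map tail-zero (partsAux-startsPositive n j (suc i))))
    where
    tail-zero : ∀ {lam} → StartsPositive lam → g (suc i ∷ lam) ≡ 0
    tail-zero {suc b ∷ lam} _ = g-twoRows i b lam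

-- Semistandard tableaux of one row

rowWordFrom : ℕ → List ℕ → List ℕ
rowWordFrom v [] = []
rowWordFrom v (m ∷ μ) = replicate m v ++ rowWordFrom (suc v) μ

rowWordFrom-≥ : ∀ {u v} μ → u ≤ v → All (u ≤_) (rowWordFrom v μ)
rowWordFrom-≥ [] _ = []
rowWordFrom-≥ (m ∷ μ) u≤v = ++⁺ (replicate⁺ m u≤v) (rowWordFrom-≥ μ (m≤n⇒m≤1+n u≤v))

rowWordFrom-< : ∀ v μ → All (_< v + length μ) (rowWordFrom v μ)
rowWordFrom-< v [] = []
rowWordFrom-< v (m ∷ μ) rewrite +-suc v (length μ) =
  ++⁺ (replicate⁺ m (s≤s (m≤m+n v (length μ)))) (rowWordFrom-< (suc v) μ)

length-rowWordFrom : ∀ v μ → length (rowWordFrom v μ) ≡ size μ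
length-rowWordFrom v [] = refl
length-rowWordFrom v (m ∷ μ)
  rewrite length-++ (replicate m v) {rowWordFrom (suc v) μ} | length-replicate m {v}
        | length-rowWordFrom (suc v) μ = refl

countEq-rowWordFrom-< : ∀ {i v} μ → i < v → countEq i (rowWordFrom v μ) ≡ 0
countEq-rowWordFrom-< μ i<v =
  countEq-none _ _ (All.map (λ v≤x x≡i → <-irrefl (sym x≡i) (<-≤-trans i<v v≤x)) (rowWordFrom-≥ μ ≤-refl))

countEq-rowWordFrom : ∀ v μ j → countEq (v + j) (rowWordFrom v μ) ≡ at μ (suc j)
countEq-rowWordFrom v [] j = refl
countEq-rowWordFrom v (m ∷ μ) zero
  rewrite countEq-++ (v + 0) (replicate m v) (rowWordFrom (suc v) μ) | +-identityʳ v
        | countEq-replicate m v | countEq-rowWordFrom-< μ (n<1+n v) = +-identityʳ m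
countEq-rowWordFrom v (m ∷ μ) (suc j)
  rewrite countEq-++ (v + suc j) (replicate m v) (rowWordFrom (suc v) μ)
        | countEq-none (v + suc j) (replicate m v) (replicate⁺ m (λ v≡ → m≢1+m+n v (trans v≡ (+-suc v j))))
        | +-suc v j = countEq-rowWordFrom (suc v) μ j

weaklyIncr-∷ : ∀ x ys → All (x ≤_) ys → weaklyIncr ys ≡ true → weaklyIncr (x ∷ ys) ≡ true
weaklyIncr-∷ x [] _ _ = refl
weaklyIncr-∷ x (y ∷ ys) (x≤y ∷ _) incr rewrite ≤⇒≤ᵇ-true x≤y = incr

weaklyIncr-tail : ∀ x ys → weaklyIncr (x ∷ ys) ≡ true → weaklyIncr ys ≡ true
weaklyIncr-tail x [] _ = refl
weaklyIncr-tail x (y ∷ ys) incr = ∧-trueʳ (x ≤ᵇ y) _ incr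

weaklyIncr⇒head-≤ : ∀ x ys → weaklyIncr (x ∷ ys) ≡ true → All (x ≤_) ys
weaklyIncr⇒head-≤ x [] _ = []
weaklyIncr⇒head-≤ x (y ∷ ys) incr =
  x≤y ∷ All.map (≤-trans x≤y) (weaklyIncr⇒head-≤ y ys (∧-trueʳ (x ≤ᵇ y) _ incr))
  where x≤y = ≤ᵇ-true⇒≤ x y (∧-trueˡ (x ≤ᵇ y) _ incr)

weaklyIncr-replicate-++ : ∀ m v ys → All (v ≤_) ys → weaklyIncr ys ≡ true → weaklyIncr (replicate m v ++ ys) ≡ true
weaklyIncr-replicate-++ zero v ys _ incr = incr
weaklyIncr-replicate-++ (suc m) v ys v≤ys incr =
  weaklyIncr-∷ v (replicate m v ++ ys) (++⁺ (replicate⁺ m ≤-refl) v≤ys) (weaklyIncr-replicate-++ m v ys v≤ys incr)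

weaklyIncr-rowWordFrom : ∀ v μ → weaklyIncr (rowWordFrom v μ) ≡ true
weaklyIncr-rowWordFrom v [] = refl
weaklyIncr-rowWordFrom v (m ∷ μ) =
  weaklyIncr-replicate-++ m v _ (rowWordFrom-≥ μ (n≤1+n v)) (weaklyIncr-rowWordFrom (suc v) μ)

countEq-below-head : ∀ {a} b v → a < b → weaklyIncr (b ∷ v) ≡ true → countEq a (b ∷ v) ≡ 0
countEq-below-head b v a<b incr =
  countEq-none _ (b ∷ v) (All.map (λ b≤x x≡a → <-irrefl (sym x≡a) (<-≤-trans a<b b≤x))
                                  (≤-refl ∷ weaklyIncr⇒head-≤ b v incr))

countEq-∷-cancel : ∀ a u v → (∀ i → countEq i (a ∷ u) ≡ countEq i (a ∷ v)) → ∀ i → countEq i u ≡ countEq i v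
countEq-∷-cancel a u v same i with same i
... | e rewrite countEq-∷ i a u | countEq-∷ i a v with a ≡ᵇ i
...   | true = suc-injective e
...   | false = e

weaklyIncr-unique : ∀ w w' → weaklyIncr w ≡ true → weaklyIncr w' ≡ true →
  (∀ i → countEq i w ≡ countEq i w') → w ≡ w'
weaklyIncr-unique [] [] _ _ _ = refl
weaklyIncr-unique [] (b ∷ v) _ _ same = ⊥-elim (0≢1+n (trans (same b) (countEq-head b v)))
weaklyIncr-unique (a ∷ u) [] _ _ same = ⊥-elim (0≢1+n (trans (sym (same a)) (countEq-head a u)))
weaklyIncr-unique (a ∷ u) (b ∷ v) incr incr' same with <-cmp a b
... | tri< a<b _ _ =
  ⊥-elim (0≢1+n (trans (sym (countEq-below-head b v a<b incr')) (trans (sym (same a)) (countEq-head a u))))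
... | tri> _ _ b<a =
  ⊥-elim (0≢1+n (trans (sym (countEq-below-head a u b<a incr)) (trans (same b) (countEq-head b v))))
... | tri≈ _ refl _ =
  cong (a ∷_) (weaklyIncr-unique u v (weaklyIncr-tail a u incr) (weaklyIncr-tail a v incr') (countEq-∷-cancel a u v same))

at-≥length : ∀ μ j → length μ ≤ j → at μ (suc j) ≡ 0
at-≥length [] j _ = refl
at-≥length (x ∷ xs) (suc j) (s≤s len≤j) = at-≥length xs j len≤j

positive⇒≢0 : ∀ {x} → positive x ≡ true → x ≢ 0
positive⇒≢0 pos refl = true≢false (sym pos)

hasEv⇒counts-rowWord : ∀ μ w → allᵇ positive w ≡ true →
  allᵇ (λ i → countEq i w ≡ᵇ at μ i) (range1 (length μ + maxℕ w)) ≡ true →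
  ∀ i → countEq i w ≡ countEq i (rowWordFrom 1 μ)
hasEv⇒counts-rowWord μ w pos ev zero =
  trans (countEq-none 0 w (All.map positive⇒≢0 (allᵇ⇒All positive w pos))) (sym (countEq-rowWordFrom-< μ (s≤s z≤n)))
hasEv⇒counts-rowWord μ w pos ev (suc j) with j <? length μ + maxℕ w
... | yes j<B =
  trans (≡ᵇ-true⇒≡ _ _ (applyUpTo⁻ suc _ (allᵇ⇒All _ _ ev) j<B)) (sym (countEq-rowWordFrom 1 μ j))
... | no j≮B =
  trans (countEq-none (suc j) w (All.map (λ x≤max x≡ → <-irrefl x≡ (s≤s (≤-trans x≤max max≤j))) (All-≤-maxℕ w)))
        (sym (trans (countEq-rowWordFrom 1 μ j) (at-≥length μ j (≤-trans (m≤m+n (length μ) (maxℕ w)) (≮⇒≥ j≮B)))))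
  where max≤j = ≤-trans (m≤n+m (maxℕ w) (length μ)) (≮⇒≥ j≮B)

rowWord-isSST : ∀ μ → (isSST (rowWordFrom 1 μ ∷ []) ∧ hasEvSST μ (rowWordFrom 1 μ ∷ [])) ≡ true
rowWord-isSST μ
  rewrite ++-identityʳ (rowWordFrom 1 μ)
        | All⇒allᵇ positive (All.map ≤⇒≤ᵇ-true (rowWordFrom-≥ {1} {1} μ ≤-refl))
        | weaklyIncr-rowWordFrom 1 μ =
  All⇒allᵇ (λ i → countEq i (rowWordFrom 1 μ) ≡ᵇ at μ i)
    (applyUpTo⁺₂ suc (length μ + maxℕ (rowWordFrom 1 μ))
      (λ j → trans (cong (_≡ᵇ at μ (suc j)) (countEq-rowWordFrom 1 μ j)) (≡ᵇ-refl (at μ (suc j)))))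

SST-oneRow-unique : ∀ μ w → (isSST (w ∷ []) ∧ hasEvSST μ (w ∷ [])) ≡ true → w ≡ rowWordFrom 1 μ
SST-oneRow-unique μ w isSSTᵀ =
  weaklyIncr-unique w (rowWordFrom 1 μ) incr (weaklyIncr-rowWordFrom 1 μ) (hasEv⇒counts-rowWord μ w pos ev)
  where
  sst = ∧-trueˡ (isSST (w ∷ [])) _ isSSTᵀ
  pos : allᵇ positive w ≡ true
  pos = subst (λ z → allᵇ positive z ≡ true) (++-identityʳ w) (∧-trueˡ (allᵇ positive (w ++ [])) _ sst)
  incr : weaklyIncr w ≡ true
  incr = ∧-trueˡ (weaklyIncr w) _ (∧-trueˡ (allᵇ weaklyIncr (w ∷ [])) _ (∧-trueʳ (allᵇ positive (w ++ [])) _ sst))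
  ev : allᵇ (λ i → countEq i w ≡ᵇ at μ i) (range1 (length μ + maxℕ w)) ≡ true
  ev = subst (λ z → allᵇ (λ i → countEq i z ≡ᵇ at μ i) (range1 (length μ + maxℕ z)) ≡ true) (++-identityʳ w)
             (∧-trueʳ (isSST (w ∷ [])) _ isSSTᵀ)

eqᵇ : List ℕ → List ℕ → Bool
eqᵇ [] [] = true
eqᵇ (a ∷ u) (b ∷ v) = (a ≡ᵇ b) ∧ eqᵇ u v
eqᵇ _ _ = false

eqᵇ-refl : ∀ w → eqᵇ w w ≡ true
eqᵇ-refl [] = refl
eqᵇ-refl (a ∷ w) rewrite ≡ᵇ-refl a = eqᵇ-refl w

eqᵇ-true⇒≡ : ∀ u v → eqᵇ u v ≡ true → u ≡ v
eqᵇ-true⇒≡ [] [] _ = refl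
eqᵇ-true⇒≡ (a ∷ u) (b ∷ v) e =
  cong₂ _∷_ (≡ᵇ-true⇒≡ a b (∧-trueˡ (a ≡ᵇ b) _ e)) (eqᵇ-true⇒≡ u v (∧-trueʳ (a ≡ᵇ b) _ e))

isSST-oneRow≡eqᵇ-rowWord : ∀ μ w → (isSST (w ∷ []) ∧ hasEvSST μ (w ∷ [])) ≡ eqᵇ w (rowWordFrom 1 μ)
isSST-oneRow≡eqᵇ-rowWord μ w with eqᵇ w (rowWordFrom 1 μ) in w≟row
... | true rewrite eqᵇ-true⇒≡ w _ w≟row = rowWord-isSST μ
... | false with isSST (w ∷ []) ∧ hasEvSST μ (w ∷ []) in isSSTᵀ
...   | false = refl
...   | true = ⊥-elim (true≢false (begin
  true                                     ≡⟨ sym (eqᵇ-refl (rowWordFrom 1 μ)) ⟩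
  eqᵇ (rowWordFrom 1 μ) (rowWordFrom 1 μ)  ≡⟨ cong (λ z → eqᵇ z (rowWordFrom 1 μ)) (sym (SST-oneRow-unique μ w isSSTᵀ)) ⟩
  eqᵇ w (rowWordFrom 1 μ)                  ≡⟨ w≟row ⟩
  false                                    ∎))
  where open ≡-Reasoning

sumℕ-δ-range1 : ∀ m {b} → 1 ≤ b → b ≤ m → sumℕ (map (λ a → δ a b) (range1 m)) ≡ 1
sumℕ-δ-range1 zero {suc b} _ ()
sumℕ-δ-range1 (suc m) {b} 1≤b b≤1+m rewrite sumℕ-map-range1-suc (λ a → δ a b) m with b ≟ suc m
... | yes refl rewrite δ-refl (suc m) =
  cong (_+ 1) (sumℕ-map-zero _ (applyUpTo⁺₁ suc m (λ i<m → δ-≢ (λ i≡m → <-irrefl (suc-injective i≡m) i<m))))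
... | no b≢1+m rewrite δ-≢ (≢-sym b≢1+m) =
  trans (+-identityʳ _) (sumℕ-δ-range1 m 1≤b (≤-pred (≤∧≢⇒< b≤1+m b≢1+m)))

words-count : ∀ m w → All (1 ≤_) w → All (_≤ m) w → length (keep (λ v → eqᵇ v w) (words (length w) m)) ≡ 1
words-count m [] _ _ = refl
words-count m (b ∷ w) (1≤b ∷ 1≤w) (b≤m ∷ w≤m) =
  trans (length-keep-concatMap (λ v → eqᵇ v (b ∷ w)) (λ a → map (a ∷_) (words (length w) m)) (range1 m))
        (trans (cong sumℕ (map-cong first-letter (range1 m))) (sumℕ-δ-range1 m 1≤b b≤m))
  where
  first-letter : ∀ a → length (keep (λ v → eqᵇ v (b ∷ w)) (map (a ∷_) (words (length w) m))) ≡ δ a b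
  first-letter a rewrite length-keep-map (λ v → eqᵇ v (b ∷ w)) (a ∷_) (words (length w) m) with a ≡ᵇ b
  ... | true = words-count m w 1≤w w≤m
  ... | false = length-keep-none _ (words (length w) m) (All.universal (λ _ → refl) _)

-- Charge of the row word

-- A tagged word whose letters are v, v + 1, … in order of blocks: block i lists the
-- positions of the letter v + i, all but the last in proj₁ and the last one in proj₂.
Blocks : Set
Blocks = List (List ℕ × ℕ)

lettered : ℕ → List ℕ → Tagged
lettered v is = map (λ q → (q , v)) is

blockWord : ℕ → Blocks → Tagged
blockWord v [] = []
blockWord v ((is , l) ∷ bs) = lettered v is ++ (l , v) ∷ blockWord (suc v) bs

innerWord : ℕ → Blocks → Tagged
innerWord v [] = []
innerWord v ((is , l) ∷ bs) = lettered v is ++ innerWord (suc v) bs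

Chain : ℕ → List ℕ → ℕ → Set
Chain b [] l = b ≤ l
Chain b (x ∷ xs) l = b ≤ x × Chain (suc x) xs l

Ordered : ℕ → Blocks → Set
Ordered b [] = ⊤
Ordered b ((is , l) ∷ bs) = Chain b is l × Ordered (suc l) bs

Shrinking : Blocks → Set
Shrinking [] = ⊤
Shrinking (e ∷ []) = ⊤
Shrinking (e ∷ e′ ∷ bs) = length (proj₁ e′) ≤ length (proj₁ e) × Shrinking (e′ ∷ bs)

Shrinking-tail : ∀ e bs → Shrinking (e ∷ bs) → Shrinking bs
Shrinking-tail e [] _ = tt
Shrinking-tail e (e′ ∷ bs) (_ , shrinking) = shrinking

blockSizes : Blocks → List ℕ
blockSizes bs = map (λ e → suc (length (proj₁ e))) bs

innerSizes : Blocks → List ℕ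
innerSizes bs = map (λ e → length (proj₁ e)) bs

splitLast : ℕ → List ℕ → List ℕ × ℕ
splitLast x [] = [] , x
splitLast x (y ∷ ys) = x ∷ proj₁ (splitLast y ys) , proj₂ (splitLast y ys)

splitLast-++ : ∀ x ys → x ∷ ys ≡ proj₁ (splitLast x ys) ++ proj₂ (splitLast x ys) ∷ []
splitLast-++ x [] = refl
splitLast-++ x (y ∷ ys) = cong (x ∷_) (splitLast-++ y ys)

length-splitLast : ∀ x ys → length (proj₁ (splitLast x ys)) ≡ length ys
length-splitLast x [] = refl
length-splitLast x (y ∷ ys) = cong suc (length-splitLast y ys)

-- Stopping at the first block with no inner positions loses nothing on Shrinking
-- blocks: all later blocks have no inner positions either.
dropLasts : Blocks → Blocks
dropLasts [] = []
dropLasts (([] , l) ∷ bs) = []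
dropLasts ((x ∷ ys , l) ∷ bs) = splitLast x ys ∷ dropLasts bs

rangeFrom : ℕ → ℕ → List ℕ
rangeFrom v zero = []
rangeFrom v (suc k) = v ∷ rangeFrom (suc v) k

length-rangeFrom : ∀ v r → length (rangeFrom v r) ≡ r
length-rangeFrom v zero = refl
length-rangeFrom v (suc r) = cong suc (length-rangeFrom (suc v) r)

triangle : ℕ → ℕ → ℕ
triangle i zero = 0
triangle i (suc r) = i + triangle (suc i) r

nAux-map-suc : ∀ i xs → nAux i (map suc xs) ≡ triangle i (length xs) + nAux i xs
nAux-map-suc i [] = refl
nAux-map-suc i (x ∷ xs) rewrite *-suc i x | nAux-map-suc (suc i) xs =
  solve 4 (λ a b c d → (a :+ b) :+ (c :+ d) := (a :+ c) :+ (b :+ d)) refl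
          i (i * x) (triangle (suc i) (length xs)) (nAux (suc i) xs)

nAux-innerSizes-empty : ∀ l bs → Shrinking (([] , l) ∷ bs) → ∀ j → nAux j (innerSizes bs) ≡ 0
nAux-innerSizes-empty l [] _ j = refl
nAux-innerSizes-empty l (([] , l′) ∷ bs) (z≤n , shrinking) j rewrite *-zeroʳ j =
  nAux-innerSizes-empty l′ bs shrinking (suc j)

nAux-innerSizes : ∀ i bs → Shrinking bs → nAux i (innerSizes bs) ≡ nAux i (blockSizes (dropLasts bs))
nAux-innerSizes i [] _ = refl
nAux-innerSizes i (([] , l) ∷ bs) shrinking rewrite *-zeroʳ i = nAux-innerSizes-empty l bs shrinking (suc i)
nAux-innerSizes i ((x ∷ ys , l) ∷ bs) shrinking =
  cong₂ _+_ (cong (λ n → i * suc n) (sym (length-splitLast x ys)))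
            (nAux-innerSizes (suc i) bs (Shrinking-tail _ bs shrinking))

blockSizes≡map-suc-innerSizes : ∀ bs → blockSizes bs ≡ map suc (innerSizes bs)
blockSizes≡map-suc-innerSizes [] = refl
blockSizes≡map-suc-innerSizes (e ∷ bs) = cong (suc (length (proj₁ e)) ∷_) (blockSizes≡map-suc-innerSizes bs)

nOf-blockSizes-dropLasts : ∀ bs → Shrinking bs →
  nOf (blockSizes bs) ≡ triangle 0 (length bs) + nOf (blockSizes (dropLasts bs))
nOf-blockSizes-dropLasts bs shrinking
  rewrite blockSizes≡map-suc-innerSizes bs | nAux-map-suc 0 (innerSizes bs) | nAux-innerSizes 0 bs shrinking
        | length-map (λ e → length (proj₁ e)) bs = refl

∸≡suc∸suc : ∀ j s → s < j → j ∸ s ≡ suc (j ∸ suc s)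
∸≡suc∸suc (suc j) zero _ = refl
∸≡suc∸suc (suc j) (suc s) (s≤s s<j) = ∸≡suc∸suc j s s<j

posOf-rangeFrom : ∀ s n j → s ≤ j → j < s + n → posOf j (rangeFrom s n) ≡ j ∸ s
posOf-rangeFrom s zero j s≤j j<s+0 = ⊥-elim (<-irrefl refl (<-≤-trans j<s+0 (≤-trans (≤-reflexive (+-identityʳ s)) s≤j)))
posOf-rangeFrom s (suc n) j s≤j j<s+1+n with s ≟ j
... | yes refl rewrite ≡ᵇ-refl s = sym (n∸n≡0 s)
... | no s≢j rewrite ≢⇒≡ᵇ-false s≢j =
  trans (cong suc (posOf-rangeFrom (suc s) n j s<j (subst (j <_) (+-suc s n) j<s+1+n))) (sym (∸≡suc∸suc j s s<j))
  where s<j = ≤∧≢⇒< s≤j s≢j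

permChargeAux-increasing : ∀ V k i c → (∀ j → i ≤ j → j < i + k → (posOf (j ∸ 1) V <ᵇ posOf j V) ≡ true) →
  permChargeAux V k i c ≡ triangle (suc c) k
permChargeAux-increasing V zero i c _ = refl
permChargeAux-increasing V (suc k) i c increasing
  rewrite increasing i ≤-refl (≤-trans (s≤s (m≤m+n i k)) (≤-reflexive (sym (+-suc i k)))) =
  cong (λ n → suc c + n) (permChargeAux-increasing V k (suc i) (suc c)
    (λ j i<j j<i+k → increasing j (≤-trans (n≤1+n i) i<j) (subst (j <_) (sym (+-suc i k)) j<i+k)))

permCharge-rangeFrom : ∀ r → permCharge (rangeFrom 1 r) ≡ triangle 0 r
permCharge-rangeFrom zero = refl
permCharge-rangeFrom (suc r) rewrite length-rangeFrom 2 r =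
  permChargeAux-increasing (rangeFrom 1 (suc r)) r 2 0 increasing
  where
  increasing : ∀ j → 2 ≤ j → j < 2 + r → (posOf (j ∸ 1) (rangeFrom 1 (suc r)) <ᵇ posOf j (rangeFrom 1 (suc r))) ≡ true
  increasing (suc (suc j)) (s≤s (s≤s z≤n)) j<2+r
    rewrite posOf-rangeFrom 1 (suc r) (suc j) (s≤s z≤n) (≤-trans (n≤1+n _) j<2+r)
          | posOf-rangeFrom 1 (suc r) (suc (suc j)) (s≤s z≤n) j<2+r = <⇒<ᵇ-true (n<1+n j)

rightmostBefore-none : ∀ i p ws → All (λ e → ((proj₂ e ≡ᵇ i) ∧ (proj₁ e <ᵇ p)) ≡ false) ws →
  rightmostBefore i p ws ≡ nothing
rightmostBefore-none i p [] [] = refl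
rightmostBefore-none i p ((q , x) ∷ ws) (e ∷ es) rewrite rightmostBefore-none i p ws es | e = refl

rightmostBefore-last : ∀ i p q pre post → q < p → rightmostBefore i p post ≡ nothing →
  rightmostBefore i p (pre ++ (q , i) ∷ post) ≡ just q
rightmostBefore-last i p q [] post q<p none rewrite none | ≡ᵇ-refl i | <⇒<ᵇ-true q<p = refl
rightmostBefore-last i p q ((q′ , x) ∷ pre) post q<p none rewrite rightmostBefore-last i p q pre post q<p none = refl

pick-just : ∀ i p ws q → rightmostBefore i p ws ≡ just q → pick i p ws ≡ just q
pick-just i p ws q e rewrite e = refl

pick-nothing : ∀ i p ws → rightmostBefore i p ws ≡ nothing →
  pick i p ws ≡ rightmostBefore i (suc (maxℕ (map proj₁ ws))) ws
pick-nothing i p ws e rewrite e = refl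

≤-maxℕ-positions : ∀ (pre : Tagged) l v post → l ≤ maxℕ (map proj₁ (pre ++ (l , v) ∷ post))
≤-maxℕ-positions [] l v post = m≤m⊔n l _
≤-maxℕ-positions ((q , x) ∷ pre) l v post = ≤-trans (≤-maxℕ-positions pre l v post) (m≤n⊔m q _)

blockWord-letters-≥ : ∀ u bs → All (λ e → u ≤ proj₂ e) (blockWord u bs)
blockWord-letters-≥ u [] = []
blockWord-letters-≥ u ((is , l) ∷ bs) =
  ++⁺ (map⁺ (All.universal (λ _ → ≤-refl) is))
      (≤-refl ∷ All.map (≤-trans (n≤1+n u)) (blockWord-letters-≥ (suc u) bs))

Chain⇒bounds : ∀ b is l → Chain b is l → All (b ≤_) is × All (_< l) is × b ≤ l
Chain⇒bounds b [] l b≤l = [] , [] , b≤l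
Chain⇒bounds b (x ∷ xs) l (b≤x , chain) with Chain⇒bounds (suc x) xs l chain
... | x<xs , xs<l , x<l =
  (b≤x ∷ All.map (≤-trans (≤-trans b≤x (n≤1+n x))) x<xs) , (x<l ∷ xs<l) , ≤-trans b≤x (≤-trans (n≤1+n x) x<l)

-- The scan for the next letter starts at p: either after the last occurrence in the
-- next block, or before the whole block, so that it cycles round to the right end.
StartAfter : ℕ → ℕ → Blocks → Set
StartAfter p b [] = ⊤
StartAfter p b ((is , l) ∷ _) = l < p ⊎ p < b

rightmostBefore-later-blocks : ∀ v suf p → rightmostBefore v p (blockWord (suc v) suf) ≡ nothing
rightmostBefore-later-blocks v suf p =
  rightmostBefore-none v p _
    (All.map (λ {e} v<e → cong (_∧ (proj₁ e <ᵇ p)) (≢⇒≡ᵇ-false (λ e≡v → <-irrefl (sym e≡v) v<e)))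
                                      (blockWord-letters-≥ (suc v) suf))

++-blockWord-∷ : ∀ X v is l suf →
  X ++ blockWord v ((is , l) ∷ suf) ≡ (X ++ lettered v is) ++ (l , v) ∷ blockWord (suc v) suf
++-blockWord-∷ X v is l suf = sym (++-assoc X (lettered v is) ((l , v) ∷ blockWord (suc v) suf))

pick-blockWord : ∀ W X v is l suf p b → W ≡ X ++ blockWord v ((is , l) ∷ suf) → All (λ e → proj₂ e < v) X →
  Chain b is l → l < p ⊎ p < b → pick v p W ≡ just l
pick-blockWord W X v is l suf p b W≡ X<v chain (inj₁ l<p) =
  pick-just v p W l (trans (cong (rightmostBefore v p) (trans W≡ (++-blockWord-∷ X v is l suf)))
                           (rightmostBefore-last v p l (X ++ lettered v is) _ l<p (rightmostBefore-later-blocks v suf p)))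
pick-blockWord W X v is l suf p b W≡ X<v chain (inj₂ p<b) =
  trans (pick-nothing v p W nothing-before-p)
        (trans (cong (rightmostBefore v P) (trans W≡ (++-blockWord-∷ X v is l suf)))
               (rightmostBefore-last v P l (X ++ lettered v is) _ l<P (rightmostBefore-later-blocks v suf P)))
  where
  P = suc (maxℕ (map proj₁ W))
  l<P : l < P
  l<P = s≤s (subst (λ z → l ≤ maxℕ (map proj₁ z)) (sym (trans W≡ (++-blockWord-∷ X v is l suf)))
                   (≤-maxℕ-positions (X ++ lettered v is) l v _))
  bounds = Chain⇒bounds b is l chain
  not-v-before-p : ∀ {q} → b ≤ q → ((v ≡ᵇ v) ∧ (q <ᵇ p)) ≡ false
  not-v-before-p {q} b≤q =
    trans (cong (_∧ (q <ᵇ p)) (≡ᵇ-refl v)) (≤⇒<ᵇ-false (≤-trans (n≤1+n p) (≤-trans p<b b≤q)))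
  nothing-before-p : rightmostBefore v p W ≡ nothing
  nothing-before-p = trans (cong (rightmostBefore v p) W≡) (rightmostBefore-none v p _
    (++⁺ (All.map (λ {e} e<v → cong (_∧ (proj₁ e <ᵇ p)) (≢⇒≡ᵇ-false (λ e≡v → <-irrefl e≡v e<v))) X<v)
         (++⁺ (map⁺ (All.map not-v-before-p (proj₁ bounds)))
              (not-v-before-p (proj₂ (proj₂ bounds)) ∷
               All.map (λ {e} v<e → cong (_∧ (proj₁ e <ᵇ p)) (≢⇒≡ᵇ-false (λ e≡v → <-irrefl (sym e≡v) v<e)))
                       (blockWord-letters-≥ (suc v) suf)))))

marks-blockWord : ∀ W X v suf p b → W ≡ X ++ blockWord v suf → All (λ e → proj₂ e < v) X → Ordered b suf →
  StartAfter p b suf → marks (length suf) v p W ≡ map proj₂ suf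
marks-blockWord W X v [] p b W≡ X<v ordered start = refl
marks-blockWord W X v ((is , l) ∷ suf) p b W≡ X<v (chain , ordered) start
  rewrite pick-blockWord W X v is l suf p b W≡ X<v chain start =
  cong (l ∷_) (marks-blockWord W X′ (suc v) suf l (suc l) W≡′ X′<1+v ordered (start′ suf))
  where
  X′ = X ++ (lettered v is ++ (l , v) ∷ [])
  W≡′ : W ≡ X′ ++ blockWord (suc v) suf
  W≡′ = trans W≡ (trans (cong (X ++_) (sym (++-assoc (lettered v is) ((l , v) ∷ []) (blockWord (suc v) suf))))
                        (sym (++-assoc X (lettered v is ++ (l , v) ∷ []) (blockWord (suc v) suf))))
  X′<1+v : All (λ e → proj₂ e < suc v) X′
  X′<1+v = ++⁺ (All.map (λ e<v → ≤-trans e<v (n≤1+n v)) X<v)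
               (++⁺ (map⁺ (All.universal (λ _ → ≤-refl) is)) (≤-refl ∷ []))
  start′ : ∀ suf → StartAfter l (suc l) suf
  start′ [] = tt
  start′ (_ ∷ _) = inj₂ ≤-refl

Ordered-lasts-≥ : ∀ b bs → Ordered b bs → All (b ≤_) (map proj₂ bs)
Ordered-lasts-≥ b [] _ = []
Ordered-lasts-≥ b ((is , l) ∷ bs) (chain , ordered) =
  b≤l ∷ All.map (≤-trans (≤-trans b≤l (n≤1+n l))) (Ordered-lasts-≥ (suc l) bs ordered)
  where b≤l = proj₂ (proj₂ (Chain⇒bounds b is l chain))

memℕ-below : ∀ q ys → All (q <_) ys → memℕ q ys ≡ false
memℕ-below q [] [] = refl
memℕ-below q (y ∷ ys) (q<y ∷ q<ys) rewrite ≢⇒≡ᵇ-false (λ y≡q → <-irrefl (sym y≡q) q<y) = memℕ-below q ys q<ys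

keep-lettered-unmarked : ∀ (Ls : List ℕ) v is → All (λ q → memℕ q Ls ≡ false) is →
  keep (λ e → memℕ (proj₁ e) Ls) (lettered v is) ≡ [] ×
  keep (λ e → not (memℕ (proj₁ e) Ls)) (lettered v is) ≡ lettered v is
keep-lettered-unmarked Ls v [] [] = refl , refl
keep-lettered-unmarked Ls v (q ∷ is) (q∉ ∷ is∉) rewrite q∉ =
  proj₁ (keep-lettered-unmarked Ls v is is∉) , cong ((q , v) ∷_) (proj₂ (keep-lettered-unmarked Ls v is is∉))

split-marked : ∀ Ls v suf b → Ordered b suf → (∀ q → b ≤ q → memℕ q Ls ≡ memℕ q (map proj₂ suf)) →
  (map proj₂ (keep (λ e → memℕ (proj₁ e) Ls) (blockWord v suf)) ≡ rangeFrom v (length suf)) ×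
  (keep (λ e → not (memℕ (proj₁ e) Ls)) (blockWord v suf) ≡ innerWord v suf)
split-marked Ls v [] b _ _ = refl , refl
split-marked Ls v ((is , l) ∷ suf) b (chain , ordered) marked≡lasts =
  trans (cong (map proj₂) (keep-++ marked (lettered v is) ((l , v) ∷ later)))
        (trans (cong (λ z → map proj₂ (z ++ keep marked ((l , v) ∷ later))) (proj₁ inner))
               (trans (cong (map proj₂) keep-last) (cong (v ∷_) (proj₁ rest)))) ,
  trans (keep-++ unmarked′ (lettered v is) ((l , v) ∷ later))
        (trans (cong (_++ keep unmarked′ ((l , v) ∷ later)) (proj₂ inner))
               (cong (lettered v is ++_) (trans drop-last (proj₂ rest))))
  where
  later = blockWord (suc v) suf
  marked = λ (e : ℕ × ℕ) → memℕ (proj₁ e) Ls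
  unmarked′ = λ (e : ℕ × ℕ) → not (memℕ (proj₁ e) Ls)
  bounds = Chain⇒bounds b is l chain
  later-lasts = Ordered-lasts-≥ (suc l) suf ordered
  inner-unmarked : ∀ {q} → b ≤ q × q < l → memℕ q Ls ≡ false
  inner-unmarked {q} (b≤q , q<l) =
    trans (marked≡lasts q b≤q)
          (trans (cong (_∨ memℕ q (map proj₂ suf)) (≢⇒≡ᵇ-false (λ l≡q → <-irrefl (sym l≡q) q<l)))
                 (memℕ-below q _ (All.map (λ 1+l≤ → ≤-trans q<l (≤-trans (n≤1+n l) 1+l≤)) later-lasts)))
  inner = keep-lettered-unmarked Ls v is (All.zipWith inner-unmarked (proj₁ bounds , proj₁ (proj₂ bounds)))
  last-marked : memℕ l Ls ≡ true
  last-marked rewrite marked≡lasts l (proj₂ (proj₂ bounds)) | ≡ᵇ-refl l = refl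
  keep-last : keep marked ((l , v) ∷ later) ≡ (l , v) ∷ keep marked later
  keep-last rewrite last-marked = refl
  drop-last : keep unmarked′ ((l , v) ∷ later) ≡ keep unmarked′ later
  drop-last rewrite last-marked = refl
  marked≡later-lasts : ∀ q → suc l ≤ q → memℕ q Ls ≡ memℕ q (map proj₂ suf)
  marked≡later-lasts q 1+l≤q rewrite marked≡lasts q (≤-trans (proj₂ (proj₂ bounds)) (≤-trans (n≤1+n l) 1+l≤q))
                                   | ≢⇒≡ᵇ-false (λ l≡q → <-irrefl l≡q 1+l≤q) = refl
  rest = split-marked Ls (suc v) suf (suc l) ordered marked≡later-lasts

innerWord-empty : ∀ u l bs → Shrinking (([] , l) ∷ bs) → innerWord u bs ≡ []
innerWord-empty u l [] _ = refl
innerWord-empty u l (([] , l′) ∷ bs) (z≤n , shrinking) = innerWord-empty (suc u) l′ bs shrinking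

innerWord≡blockWord-dropLasts : ∀ v bs → Shrinking bs → innerWord v bs ≡ blockWord v (dropLasts bs)
innerWord≡blockWord-dropLasts v [] _ = refl
innerWord≡blockWord-dropLasts v (([] , l) ∷ bs) shrinking = innerWord-empty (suc v) l bs shrinking
innerWord≡blockWord-dropLasts v ((x ∷ ys , l) ∷ bs) shrinking = begin
  lettered v (x ∷ ys) ++ innerWord (suc v) bs
    ≡⟨ cong (λ zs → lettered v zs ++ innerWord (suc v) bs) (splitLast-++ x ys) ⟩
  lettered v (init ++ last ∷ []) ++ innerWord (suc v) bs
    ≡⟨ cong (_++ innerWord (suc v) bs) (map-++ (λ q → (q , v)) init (last ∷ [])) ⟩
  (lettered v init ++ (last , v) ∷ []) ++ innerWord (suc v) bs
    ≡⟨ ++-assoc (lettered v init) ((last , v) ∷ []) (innerWord (suc v) bs) ⟩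
  lettered v init ++ (last , v) ∷ innerWord (suc v) bs
    ≡⟨ cong (λ w → lettered v init ++ (last , v) ∷ w)
            (innerWord≡blockWord-dropLasts (suc v) bs (Shrinking-tail _ bs shrinking)) ⟩
  blockWord v (dropLasts ((x ∷ ys , l) ∷ bs)) ∎
  where
  open ≡-Reasoning
  init = proj₁ (splitLast x ys)
  last = proj₂ (splitLast x ys)

Chain-splitLast : ∀ b x ys l → b ≤ x → Chain (suc x) ys l →
  Chain b (proj₁ (splitLast x ys)) (proj₂ (splitLast x ys)) × proj₂ (splitLast x ys) < l
Chain-splitLast b x [] l b≤x x<l = b≤x , x<l
Chain-splitLast b x (y ∷ ys) l b≤x (x<y , chain) with Chain-splitLast (suc x) y ys l x<y chain
... | chain′ , last<l = (b≤x , chain′) , last<l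

Chain-mono : ∀ {b′ b} is l → b′ ≤ b → Chain b is l → Chain b′ is l
Chain-mono [] l b′≤b b≤l = ≤-trans b′≤b b≤l
Chain-mono (x ∷ xs) l b′≤b (b≤x , chain) = ≤-trans b′≤b b≤x , chain

Ordered-mono : ∀ {b′ b} bs → b′ ≤ b → Ordered b bs → Ordered b′ bs
Ordered-mono [] _ _ = tt
Ordered-mono ((is , l) ∷ bs) b′≤b (chain , ordered) = Chain-mono is l b′≤b chain , ordered

Ordered-dropLasts : ∀ b bs → Ordered b bs → Ordered b (dropLasts bs)
Ordered-dropLasts b [] _ = tt
Ordered-dropLasts b (([] , l) ∷ bs) _ = tt
Ordered-dropLasts b ((x ∷ ys , l) ∷ bs) ((b≤x , chain) , ordered) with Chain-splitLast b x ys l b≤x chain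
... | chain′ , last<l = chain′ , Ordered-mono (dropLasts bs) (≤-trans last<l (n≤1+n l)) (Ordered-dropLasts (suc l) bs ordered)

Shrinking-dropLasts : ∀ bs → Shrinking bs → Shrinking (dropLasts bs)
Shrinking-dropLasts [] _ = tt
Shrinking-dropLasts (([] , l) ∷ bs) _ = tt
Shrinking-dropLasts ((x ∷ ys , l) ∷ []) _ = tt
Shrinking-dropLasts ((x ∷ ys , l) ∷ ([] , l′) ∷ bs) _ = tt
Shrinking-dropLasts ((x ∷ ys , l) ∷ (x′ ∷ ys′ , l′) ∷ bs) (s≤s ys′≤ys , shrinking) =
  subst₂ _≤_ (sym (length-splitLast x′ ys′)) (sym (length-splitLast x ys)) ys′≤ys ,
  Shrinking-dropLasts ((x′ ∷ ys′ , l′) ∷ bs) shrinking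

length-innerWord : ∀ v bs → length (innerWord v bs) + length bs ≡ length (blockWord v bs)
length-innerWord v [] = refl
length-innerWord v ((is , l) ∷ bs)
  rewrite length-++ (lettered v is) {innerWord (suc v) bs} | length-++ (lettered v is) {(l , v) ∷ blockWord (suc v) bs}
        | sym (length-innerWord (suc v) bs) =
  trans (+-assoc (length (lettered v is)) _ (suc (length bs)))
        (cong (λ n → length (lettered v is) + n) (+-suc (length (innerWord (suc v) bs)) (length bs)))

innerWord-shorter : ∀ v b bs → suc (length (innerWord v (b ∷ bs))) ≤ length (blockWord v (b ∷ bs))
innerWord-shorter v b bs =
  subst (suc (length (innerWord v (b ∷ bs))) ≤_) (length-innerWord v (b ∷ bs))
        (≤-trans (s≤s (m≤m+n _ (length bs))) (≤-reflexive (sym (+-suc _ (length bs)))))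

maxℕ-letters-blockWord : ∀ v bs → maxℕ (map proj₂ (blockWord (suc v) bs)) ⊔ v ≡ v + length bs
maxℕ-letters-blockWord v [] = trans (⊔-identityˡ v) (sym (+-identityʳ v))
maxℕ-letters-blockWord v ((is , l) ∷ bs) = begin
  maxℕ (map proj₂ (lettered (suc v) is ++ (l , suc v) ∷ blockWord (suc (suc v)) bs)) ⊔ v
    ≡⟨ cong (_⊔ v) (maxℕ-block is) ⟩
  (suc v ⊔ M) ⊔ v
    ≡⟨ m≥n⇒m⊔n≡m (≤-trans (n≤1+n v) (m≤m⊔n (suc v) M)) ⟩
  suc v ⊔ M
    ≡⟨ ⊔-comm (suc v) M ⟩
  M ⊔ suc v
    ≡⟨ maxℕ-letters-blockWord (suc v) bs ⟩
  suc v + length bs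
    ≡⟨ sym (+-suc v (length bs)) ⟩
  v + suc (length bs) ∎
  where
  open ≡-Reasoning
  M = maxℕ (map proj₂ (blockWord (suc (suc v)) bs))
  maxℕ-block : ∀ is → maxℕ (map proj₂ (lettered (suc v) is ++ (l , suc v) ∷ blockWord (suc (suc v)) bs)) ≡ suc v ⊔ M
  maxℕ-block [] = refl
  maxℕ-block (q ∷ is) =
    trans (cong (suc v ⊔_) (maxℕ-block is)) (trans (sym (⊔-assoc (suc v) (suc v) M)) (cong (_⊔ M) (⊔-idem (suc v))))

markedPositions : Tagged → List ℕ
markedPositions W = marks (maxℕ (map proj₂ W)) 1 (suc (maxℕ (map proj₁ W))) W

chargeSubword : Tagged → List ℕ
chargeSubword W = map proj₂ (keep (λ e → memℕ (proj₁ e) (markedPositions W)) W)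

unmarked : Tagged → Tagged
unmarked W = keep (λ e → not (memℕ (proj₁ e) (markedPositions W))) W

chargeTagged-step : ∀ f W → 0 < length W →
  chargeTagged (suc f) W ≡ permCharge (chargeSubword W) + chargeTagged f (unmarked W)
chargeTagged-step f (w ∷ ws) _ = refl

chargeTagged-nil : ∀ f → chargeTagged f [] ≡ 0
chargeTagged-nil zero = refl
chargeTagged-nil (suc f) = refl

chargeTagged-blockWord : ∀ f bs → Ordered 0 bs → Shrinking bs → length (blockWord 1 bs) ≤ f →
  chargeTagged f (blockWord 1 bs) ≡ nOf (blockSizes bs)
chargeTagged-blockWord f [] _ _ _ = chargeTagged-nil f
chargeTagged-blockWord zero (b ∷ bs) _ _ len≤ with ≤-trans (innerWord-shorter 1 b bs) len≤
... | ()
chargeTagged-blockWord (suc f) bs@((is , l) ∷ bs′) ordered shrinking len≤ = begin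
  chargeTagged (suc f) W
    ≡⟨ chargeTagged-step f W (≤-trans (s≤s z≤n) (innerWord-shorter 1 (is , l) bs′)) ⟩
  permCharge (chargeSubword W) + chargeTagged f (unmarked W)
    ≡⟨ cong₂ (λ u r → permCharge u + chargeTagged f r) subword≡ unmarked≡ ⟩
  permCharge (rangeFrom 1 (length bs)) + chargeTagged f (blockWord 1 (dropLasts bs))
    ≡⟨ cong₂ _+_ (permCharge-rangeFrom (length bs))
                 (chargeTagged-blockWord f (dropLasts bs) (Ordered-dropLasts 0 bs ordered)
                                         (Shrinking-dropLasts bs shrinking) rest≤) ⟩
  triangle 0 (length bs) + nOf (blockSizes (dropLasts bs))
    ≡⟨ sym (nOf-blockSizes-dropLasts bs shrinking) ⟩
  nOf (blockSizes bs) ∎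
  where
  open ≡-Reasoning
  W = blockWord 1 bs
  marked≡ : markedPositions W ≡ map proj₂ bs
  marked≡ = trans (cong (λ n → marks n 1 (suc (maxℕ (map proj₁ W))) W)
                        (trans (sym (⊔-identityʳ _)) (maxℕ-letters-blockWord 0 bs)))
                  (marks-blockWord W [] 1 bs _ 0 refl [] ordered
                                   (inj₁ (s≤s (≤-maxℕ-positions (lettered 1 is) l 1 (blockWord 2 bs′)))))
  split = split-marked (map proj₂ bs) 1 bs 0 ordered (λ _ _ → refl)
  subword≡ : chargeSubword W ≡ rangeFrom 1 (length bs)
  subword≡ = trans (cong (λ P → map proj₂ (keep (λ e → memℕ (proj₁ e) P) W)) marked≡) (proj₁ split)
  unmarked≡ : unmarked W ≡ blockWord 1 (dropLasts bs)
  unmarked≡ = trans (cong (λ P → keep (λ e → not (memℕ (proj₁ e) P)) W) marked≡)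
                    (trans (proj₂ split) (innerWord≡blockWord-dropLasts 1 bs shrinking))
  rest≤ : length (blockWord 1 (dropLasts bs)) ≤ f
  rest≤ = subst (λ w → length w ≤ f) (innerWord≡blockWord-dropLasts 1 bs shrinking)
                (≤-pred (≤-trans (innerWord-shorter 1 (is , l) bs′) len≤))

tagFrom : ℕ → List ℕ → Tagged
tagFrom b [] = []
tagFrom b (x ∷ xs) = (b , x) ∷ tagFrom (suc b) xs

zip-applyUpTo≡tagFrom : ∀ (f : ℕ → ℕ) b w → (∀ i → f i ≡ b + i) → zip (applyUpTo f (length w)) w ≡ tagFrom b w
zip-applyUpTo≡tagFrom f b [] _ = refl
zip-applyUpTo≡tagFrom f b (x ∷ w) f≗b+ =
  cong₂ _∷_ (cong (_, x) (trans (f≗b+ 0) (+-identityʳ b)))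
            (zip-applyUpTo≡tagFrom (λ i → f (suc i)) (suc b) w (λ i → trans (f≗b+ (suc i)) (+-suc b i)))

length-tagFrom : ∀ b w → length (tagFrom b w) ≡ length w
length-tagFrom b [] = refl
length-tagFrom b (x ∷ w) = cong suc (length-tagFrom (suc b) w)

rowBlocks : ℕ → List ℕ → Blocks
rowBlocks b [] = []
rowBlocks b (zero ∷ μ) = []
rowBlocks b (suc m ∷ μ) = (rangeFrom b m , b + m) ∷ rowBlocks (suc (b + m)) μ

tagFrom-replicate-++ : ∀ b m v rest →
  tagFrom b (replicate (suc m) v ++ rest) ≡ lettered v (rangeFrom b m) ++ (b + m , v) ∷ tagFrom (suc (b + m)) rest
tagFrom-replicate-++ b zero v rest rewrite +-identityʳ b = refl
tagFrom-replicate-++ b (suc m) v rest rewrite +-suc b m = cong ((b , v) ∷_) (tagFrom-replicate-++ (suc b) m v rest)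

tagFrom-rowWord : ∀ b v μ → All (1 ≤_) μ → tagFrom b (rowWordFrom v μ) ≡ blockWord v (rowBlocks b μ)
tagFrom-rowWord b v [] _ = refl
tagFrom-rowWord b v (suc m ∷ μ) (_ ∷ μ-positive) =
  trans (tagFrom-replicate-++ b m v (rowWordFrom (suc v) μ))
        (cong (λ w → lettered v (rangeFrom b m) ++ (b + m , v) ∷ w) (tagFrom-rowWord (suc (b + m)) (suc v) μ μ-positive))

Chain-rangeFrom : ∀ b m → Chain b (rangeFrom b m) (b + m)
Chain-rangeFrom b zero = m≤m+n b 0
Chain-rangeFrom b (suc m) = ≤-refl , subst (Chain (suc b) (rangeFrom (suc b) m)) (sym (+-suc b m)) (Chain-rangeFrom (suc b) m)

Ordered-rowBlocks : ∀ b μ → Ordered b (rowBlocks b μ)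
Ordered-rowBlocks b [] = tt
Ordered-rowBlocks b (zero ∷ μ) = tt
Ordered-rowBlocks b (suc m ∷ μ) = Chain-rangeFrom b m , Ordered-rowBlocks (suc (b + m)) μ

Shrinking-rowBlocks : ∀ b μ → weaklyDecr μ ≡ true → Shrinking (rowBlocks b μ)
Shrinking-rowBlocks b [] _ = tt
Shrinking-rowBlocks b (zero ∷ μ) _ = tt
Shrinking-rowBlocks b (suc m ∷ []) _ = tt
Shrinking-rowBlocks b (suc m ∷ zero ∷ μ) _ = tt
Shrinking-rowBlocks b (suc m ∷ suc m′ ∷ μ) decr =
  subst₂ _≤_ (sym (length-rangeFrom (suc (b + m)) m′)) (sym (length-rangeFrom b m))
         (≤-pred (≤ᵇ-true⇒≤ (suc m′) (suc m) (∧-trueˡ (suc m′ ≤ᵇ suc m) _ decr))) ,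
  Shrinking-rowBlocks (suc (b + m)) (suc m′ ∷ μ) (∧-trueʳ (suc m′ ≤ᵇ suc m) _ decr)

blockSizes-rowBlocks : ∀ b μ → All (1 ≤_) μ → blockSizes (rowBlocks b μ) ≡ μ
blockSizes-rowBlocks b [] _ = refl
blockSizes-rowBlocks b (suc m ∷ μ) (_ ∷ μ-positive) =
  cong₂ _∷_ (cong suc (length-rangeFrom b m)) (blockSizes-rowBlocks (suc (b + m)) μ μ-positive)

charge-rowWord : ∀ μ → IsPartition μ → charge (rowWordFrom 1 μ) ≡ nOf μ
charge-rowWord μ μ-partition = begin
  chargeTagged (length w) (tag w)
    ≡⟨ cong (chargeTagged (length w)) (trans (zip-applyUpTo≡tagFrom (λ i → i) 0 w (λ _ → refl)) tag≡) ⟩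
  chargeTagged (length w) (blockWord 1 (rowBlocks 0 μ))
    ≡⟨ chargeTagged-blockWord (length w) (rowBlocks 0 μ) (Ordered-rowBlocks 0 μ) (Shrinking-rowBlocks 0 μ decr)
         (≤-reflexive (trans (cong length (sym tag≡)) (length-tagFrom 0 w))) ⟩
  nOf (blockSizes (rowBlocks 0 μ))
    ≡⟨ cong nOf (blockSizes-rowBlocks 0 μ μ-positive) ⟩
  nOf μ ∎
  where
  open ≡-Reasoning
  w = rowWordFrom 1 μ
  partitionᵇ = T⇒≡true μ-partition
  decr = ∧-trueˡ (weaklyDecr μ) _ partitionᵇ
  μ-positive : All (1 ≤_) μ
  μ-positive = All.map (≤ᵇ-true⇒≤ 1 _) (allᵇ⇒All positive μ (∧-trueʳ (weaklyDecr μ) _ partitionᵇ))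
  tag≡ : tagFrom 0 w ≡ blockWord 1 (rowBlocks 0 μ)
  tag≡ = tagFrom-rowWord 0 1 μ μ-positive

-- Hall–Littlewood functions in one variable

SST-oneRow-chargeCount : ∀ μ → IsPartition μ → ∀ k →
  length (keep (λ F → charge (readingWord F) ≡ᵇ k) (SST (size μ ∷ []) μ)) ≡ δ (nOf μ) k
SST-oneRow-chargeCount μ μ-partition k = begin
  length (keep (λ F → charge (readingWord F) ≡ᵇ k) (SST (size μ ∷ []) μ))
    ≡⟨ cong (λ Fs → length (keep (λ F → charge (readingWord F) ≡ᵇ k) (keep (λ F → isSST F ∧ hasEvSST μ F) Fs)))
            (concatMap-singleton (λ w → w ∷ []) rowWords) ⟩
  length (keep (λ F → charge (readingWord F) ≡ᵇ k) (keep (λ F → isSST F ∧ hasEvSST μ F) (map (λ w → w ∷ []) rowWords)))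
    ≡⟨ length-keep-keep-map _ _ (λ w → w ∷ []) rowWords ⟩
  length (keep (λ w → (isSST (w ∷ []) ∧ hasEvSST μ (w ∷ [])) ∧ (charge (readingWord (w ∷ [])) ≡ᵇ k)) rowWords)
    ≡⟨ cong length (keep-cong rowWords test≡) ⟩
  length (keep (λ w → eqᵇ w row ∧ (nOf μ ≡ᵇ k)) rowWords)
    ≡⟨ count ⟩
  δ (nOf μ) k ∎
  where
  open ≡-Reasoning
  row = rowWordFrom 1 μ
  rowWords = words (size μ) (length μ)
  test≡ : ∀ w → ((isSST (w ∷ []) ∧ hasEvSST μ (w ∷ [])) ∧ (charge (readingWord (w ∷ [])) ≡ᵇ k))
              ≡ (eqᵇ w row ∧ (nOf μ ≡ᵇ k))
  test≡ w rewrite isSST-oneRow≡eqᵇ-rowWord μ w with eqᵇ w row in w≟row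
  ... | true rewrite eqᵇ-true⇒≡ w row w≟row | ++-identityʳ row | charge-rowWord μ μ-partition = refl
  ... | false = refl
  count : length (keep (λ w → eqᵇ w row ∧ (nOf μ ≡ᵇ k)) rowWords) ≡ δ (nOf μ) k
  count with nOf μ ≡ᵇ k
  ... | true = trans (cong length (keep-cong rowWords (λ w → ∧-identityʳ (eqᵇ w row))))
                     (subst (λ n → length (keep (λ v → eqᵇ v row) (words n (length μ))) ≡ 1) (length-rowWordFrom 1 μ)
                            (words-count (length μ) row (rowWordFrom-≥ μ ≤-refl) (All.map ≤-pred (rowWordFrom-< 1 μ))))
  ... | false = length-keep-none _ rowWords (All.universal (λ w → ∧-zeroʳ (eqᵇ w row)) rowWords)

HCoeff-oneVariable : ∀ μ → IsPartition μ → ∀ m k → HCoeff μ (m ∷ []) k ≡ δ (nOf μ) k * δ (size μ) m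
HCoeff-oneVariable [] _ zero zero = refl
HCoeff-oneVariable [] _ zero (suc k) = refl
HCoeff-oneVariable [] _ (suc m) zero = refl
HCoeff-oneVariable [] _ (suc m) (suc k) = refl
HCoeff-oneVariable (zero ∷ μ) μ-partition m k =
  ⊥-elim (true≢false (sym (∧-trueˡ false (allᵇ positive μ)
                                    (∧-trueʳ (weaklyDecr (zero ∷ μ)) _ (T⇒≡true μ-partition)))))
HCoeff-oneVariable μ@(suc x ∷ μ′) μ-partition m k = begin
  HCoeff μ (m ∷ []) k
    ≡⟨ sumℕ-partitionsOf-oneRow (x + size μ′) term
         (λ a b lam → trans (cong (chargeCount (suc a ∷ suc b ∷ lam) *_) (schurCoeff-oneVariable-twoRows a b lam m))
                            (*-zeroʳ (chargeCount (suc a ∷ suc b ∷ lam)))) ⟩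
  chargeCount (size μ ∷ []) * schurCoeff (size μ ∷ []) (m ∷ [])
    ≡⟨ cong₂ _*_ (SST-oneRow-chargeCount μ μ-partition k) (schurCoeff-oneVariable-oneRow (size μ) m) ⟩
  δ (nOf μ) k * δ (size μ) m ∎
  where
  open ≡-Reasoning
  chargeCount : List ℕ → ℕ
  chargeCount lam = length (keep (λ F → charge (readingWord F) ≡ᵇ k) (SST lam μ))
  term : List ℕ → ℕ
  term lam = chargeCount lam * schurCoeff lam (m ∷ [])

∑ᶻ-gCoeff-oneVariable : ∀ M (d : List (List ℕ × Poly)) (c : List ℕ × Poly → ℤ) →
  All (λ e → maxℕ (proj₁ e) < M) d →
  ∑ᶻ M (λ m → sumℤ (map (λ e → c e ℤ.* + gCoeff (proj₁ e) (m ∷ [])) d)) ≡ sumℤ (map c d)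
∑ᶻ-gCoeff-oneVariable M d c bounded = begin
  ∑ᶻ M (λ m → sumℤ (map (λ e → c e ℤ.* + gCoeff (proj₁ e) (m ∷ [])) d))
    ≡⟨ ∑ᶻ-cong M (λ m → cong sumℤ (map-cong (λ e → cong (λ n → c e ℤ.* + n) (gCoeff-oneVariable (proj₁ e) m)) d)) ⟩
  ∑ᶻ M (λ m → sumℤ (map (λ e → c e ℤ.* + δ (maxℕ (proj₁ e)) m) d))
    ≡⟨ ∑ᶻ-sumℤ-comm M (λ e m → c e ℤ.* + δ (maxℕ (proj₁ e)) m) d ⟩
  sumℤ (map (λ e → ∑ᶻ M (λ m → c e ℤ.* + δ (maxℕ (proj₁ e)) m)) d)
    ≡⟨ cong sumℤ (map-cong-All bounded) ⟩
  sumℤ (map c d) ∎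
  where
  open ≡-Reasoning
  map-cong-All : ∀ {es} → All (λ e → maxℕ (proj₁ e) < M) es →
    map (λ e → ∑ᶻ M (λ m → c e ℤ.* + δ (maxℕ (proj₁ e)) m)) es ≡ map c es
  map-cong-All [] = refl
  map-cong-All {e ∷ _} (e< ∷ es<) = cong₂ _∷_ (∑ᶻ-δ M (c e) e<) (map-cong-All es<)

corollary8p2 : (μ : List ℕ) → IsPartition μ →
    (d : List (List ℕ × Poly)) → GExpansion μ d →
    (k : ℕ) → sumCoeffs d k ≡ tPowCoeff (nOf μ) k
corollary8p2 μ μ-partition d (_ , expansion) k = begin
  sumCoeffs d k
    ≡⟨ sym (∑ᶻ-gCoeff-oneVariable M d (λ e → coeff (proj₂ e) k) bounded) ⟩
  ∑ᶻ M (λ m → sumℤ (map (λ e → coeff (proj₂ e) k ℤ.* + gCoeff (proj₁ e) (m ∷ [])) d))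
    ≡⟨ ∑ᶻ-cong M (λ m → sym (expansion (m ∷ []) k)) ⟩
  ∑ᶻ M (λ m → + HCoeff μ (m ∷ []) k)
    ≡⟨ ∑ᶻ-cong M (λ m → trans (cong +_ (HCoeff-oneVariable μ μ-partition m k))
                              (ZP.pos-* (δ (nOf μ) k) (δ (size μ) m))) ⟩
  ∑ᶻ M (λ m → + δ (nOf μ) k ℤ.* + δ (size μ) m)
    ≡⟨ ∑ᶻ-δ M (+ δ (nOf μ) k) (s≤s (m≤m+n (size μ) B)) ⟩
  + δ (nOf μ) k
    ≡⟨ sym (tPowCoeff≡δ (nOf μ) k) ⟩
  tPowCoeff (nOf μ) k ∎
  where
  open ≡-Reasoning
  -- M exceeds |μ| and every λ₁, so the degrees m < M of x carry all coefficients.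
  B = maxℕ (map (λ e → maxℕ (proj₁ e)) d)
  M = suc (size μ + B)
  bounded : All (λ e → maxℕ (proj₁ e) < M) d
  bounded = map⁻ (All.map (λ ≤B → s≤s (≤-trans ≤B (m≤n+m B (size μ))))
                          (All-≤-maxℕ (map (λ e → maxℕ (proj₁ e)) d)))
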